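{- Let $M$ be an $m \times n$ Boolean matrix that is $(d,e;u,g)$-disjunct, and define $\ell := u-g$. Then for every distinguishable $d$-sparse vectors $x, x' \in \{0,1\}^n$, each having support size $u$ or more and such that $|\mathrm{supp}(x) \setminus \mathrm{supp}(x')| > g$ and $\mathrm{wgt}(x) \geq |\mathrm{supp}(x') \setminus \mathrm{supp}(x)|$, the following holds: for every $y \in M[x]_{\ell,u}$ and $y' \in M[x']_{\ell,u}$, \[ |\mathrm{supp}(y) \setminus \mathrm{supp}(y')| > e. \] Conversely, assuming $n > d+g$, if $M$ satisfies this inequality for every choice of distinguishable $d$-sparse $x, x' \in \{0,1\}^n$, each with support size at least $u$, with $|\mathrm{supp}(x) \setminus \mathrm{supp}(x')| > g$ and $\mathrm{wgt}(x) \geq |\mathrm{supp}(x') \setminus \mathrm{supp}(x)|$, and every $y \in M[x]_{\ell,u}$, $y' \in M[x']_{\ell,u}$, then $M$ must be $(\lfloor d/2 \rfloor,e;u,g)$-disjunct.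
   Context: Threshold group testing with upper threshold $u$, lower threshold $\ell = u-g$ and gap $g \geq 0$, with integers $g < u \leq d \leq n$. For $x \in \{0,1\}^n$, $\mathrm{supp}(x)$ is its set of nonzero coordinates, $\mathrm{wgt}(x)=|\mathrm{supp}(x)|$, and $x$ is $d$-sparse if $\mathrm{wgt}(x) \leq d$. For an $m\times n$ Boolean matrix $M$ with rows $M_1,\dots,M_m$, $M[x]_{\ell,u}$ is the set of vectors $y \in \{0,1\}^m$ such that $y(j)=1$ whenever $|\mathrm{supp}(M_j)\cap\mathrm{supp}(x)| \geq u$ and $y(j)=0$ whenever $|\mathrm{supp}(M_j)\cap\mathrm{supp}(x)| < \ell$ (arbitrary otherwise). Two distinct $d$-sparse vectors $x,x'$ are distinguishable if at least one has support size at least $u$ and either $|\mathrm{supp}(x)\setminus\mathrm{supp}(x')| > g$ or $|\mathrm{supp}(x')\setminus\mathrm{supp}(x)| > g$. $M|_S$ denotes the restriction of $M$ to the columns in $S$. $M$ is $(d,e;u,g)$-disjunct if for every critical set $S \subseteq [n]$, zero set $Z \subseteq [n]$ with $u \leq |S| \leq d$, $|Z| \leq |S|$, $S\cap Z=\emptyset$, and every set $I \subseteq S$ of $g+1$ distinguished columns, there are more than $e$ rows of $M$ at which $M|_S$ has weight exactly $u$, $M|_Z$ has weight zero, and $M|_I$ is all ones. -}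

module Defs where

open import Data.Nat using (ℕ; zero; suc; _+_; _≤_; _<_; _≡ᵇ_)
open import Data.Bool using (Bool; true; false; _∧_; not; if_then_else_)
open import Data.Fin using (Fin)
import Data.Fin as F
open import Data.Product using (_×_)
open import Data.Sum using (_⊎_)
open import Relation.Binary.PropositionalEquality using (_≡_)
open import Relation.Nullary using (¬_)

-- Boolean vectors in {0,1}^n (true = 1); a subset of [n] is represented
-- by its indicator vector.
BVec : ℕ → Set
BVec n = Fin n → Bool

BMat : ℕ → ℕ → Set
BMat m n = Fin m → Fin n → Bool

count : ∀ {n} → BVec n → ℕ
count {zero}  x = 0
count {suc n} x = (if x F.zero then 1 else 0) + count (λ i → x (F.suc i))

wgt : ∀ {n} → BVec n → ℕ
wgt = count

inter : ∀ {n} → BVec n → BVec n → ℕ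
inter x x' = count (λ i → x i ∧ x' i)

diff : ∀ {n} → BVec n → BVec n → ℕ
diff x x' = count (λ i → x i ∧ not (x' i))

InOutcome : ∀ {m n} → BMat m n → BVec n → (ℓ u : ℕ) → BVec m → Set
InOutcome M x ℓ u y =
  ∀ j → (u ≤ inter (M j) x → y j ≡ true) × (inter (M j) x < ℓ → y j ≡ false)

Distinguishable : ∀ {n} → (d u g : ℕ) → BVec n → BVec n → Set
Distinguishable d u g x x' =
  ¬ (∀ i → x i ≡ x' i) × wgt x ≤ d × wgt x' ≤ d ×
  (u ≤ wgt x ⊎ u ≤ wgt x') × (g < diff x x' ⊎ g < diff x' x)

goodRow : ∀ {m n} → BMat m n → (u : ℕ) → (S Z I : BVec n) → Fin m → Bool
goodRow M u S Z I j =
  (inter (M j) S ≡ᵇ u) ∧ (inter (M j) Z ≡ᵇ 0) ∧ (diff I (M j) ≡ᵇ 0)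

Disjunct : ∀ {m n} → BMat m n → (d e u g : ℕ) → Set
Disjunct {m} {n} M d e u g =
  (S Z I : BVec n) →
  u ≤ count S → count S ≤ d → count Z ≤ count S →
  (∀ i → S i ≡ true → Z i ≡ false) →
  (∀ i → I i ≡ true → S i ≡ true) → count I ≡ suc g →
  e < count (goodRow M u S Z I)

Separating : ∀ {m n} → BMat m n → (d e u g ℓ : ℕ) → Set
Separating {m} {n} M d e u g ℓ =
  (x x' : BVec n) → Distinguishable d u g x x' →
  u ≤ wgt x → u ≤ wgt x' → g < diff x x' → diff x' x ≤ wgt x →
  (y y' : BVec m) → InOutcome M x ℓ u y → InOutcome M x' ℓ u y' →
  e < diff y y'

module Submission where

-- For the forward direction take S = supp x, Z = supp x′ ∖ supp x and any g + 1
-- columns I of supp x ∖ supp x′. A row meeting x in exactly u columns, missing Z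
-- and containing I meets x′ in at most u − (g + 1) < ℓ columns, so every
-- y ∈ M[x] has a one there and every y′ ∈ M[x′] a zero. Conversely, given S, Z, I
-- with |S| ≤ ⌊d/2⌋, pad Z to a set Z′ of size |S| disjoint from S (room exists as
-- 2|S| ≤ d ≤ n) and compare S with x′ = (S ∖ I) ∪ Z′; a row separating their
-- outcomes meets S in at least u columns but x′ in fewer than u − g, which is only
-- possible if it meets S in exactly u columns, contains I and misses Z′.

open import Defs
open import Data.Bool using (true; false; _∧_; _∨_; not; if_then_else_)
open import Data.Bool.Properties
  using (∧-conicalˡ; ∧-conicalʳ; ∨-zeroʳ; ∧-zeroʳ; ∧-identityʳ; ∧-assoc; ∧-comm; ∧-distribˡ-∨; not-injective; T-≡)
open import Data.Fin using (zero; suc)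
open import Data.Vec.Functional using (_∷_; tail)
open import Data.Nat using (ℕ; zero; suc; _+_; _∸_; _≤_; _<_; _*_; _/_; _≡ᵇ_; _≤?_; z≤n; s≤s; s≤s⁻¹; z<s)
open import Data.Nat.DivMod using (m/n*n≤m)
open import Data.Nat.Properties
open import Data.Product using (_×_; _,_; proj₁; proj₂; ∃-syntax)
open import Data.Sum using (inj₁)
open import Function using (_∘_; id)
open import Relation.Binary.PropositionalEquality
open import Function.Bundles using (Equivalence)
open import Relation.Nullary using (¬_; does; proof)
open import Relation.Nullary.Decidable using (dec-true; dec-false)
open import Relation.Nullary.Reflects using (Reflects; invert)

infixr 7 _∩_ _∖_
infixr 6 _∪_
infix 4 _⊆_ _≐_

∅ : ∀ {n} → BVec n
∅ _ = false

∁ : ∀ {n} → BVec n → BVec n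
∁ a i = not (a i)

_∩_ _∪_ _∖_ : ∀ {n} → BVec n → BVec n → BVec n
(a ∩ b) i = a i ∧ b i
(a ∪ b) i = a i ∨ b i
a ∖ b = a ∩ ∁ b

_⊆_ _≐_ Disjoint : ∀ {n} → BVec n → BVec n → Set
a ⊆ b = ∀ i → a i ≡ true → b i ≡ true
a ≐ b = ∀ i → a i ≡ b i
Disjoint a b = ∀ i → a i ≡ true → b i ≡ false

module _ {n : ℕ} where

  ∩-⊆ˡ : (a b : BVec n) → a ∩ b ⊆ a
  ∩-⊆ˡ a b i = ∧-conicalˡ (a i) (b i)

  ∩-⊆ʳ : (a b : BVec n) → a ∩ b ⊆ b
  ∩-⊆ʳ a b i = ∧-conicalʳ (a i) (b i)

  ∩-monoʳ : (a : BVec n) {b c : BVec n} → b ⊆ c → a ∩ b ⊆ a ∩ c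
  ∩-monoʳ a {b} b⊆c i h = cong₂ _∧_ (∧-conicalˡ (a i) (b i) h) (b⊆c i (∧-conicalʳ (a i) (b i) h))

  ⊆-∪ˡ : (a b : BVec n) → a ⊆ a ∪ b
  ⊆-∪ˡ a b i aᵢ rewrite aᵢ = refl

  ⊆-∪ʳ : (a b : BVec n) → b ⊆ a ∪ b
  ⊆-∪ʳ a b i bᵢ rewrite bᵢ = ∨-zeroʳ (a i)

  ⊆⇒∩≐ : {a b : BVec n} → b ⊆ a → a ∩ b ≐ b
  ⊆⇒∩≐ {a} {b} b⊆a i with b i in bᵢ
  ... | true  = trans (∧-identityʳ (a i)) (b⊆a i bᵢ)
  ... | false = ∧-zeroʳ (a i)

  disjoint-∖ : (a b : BVec n) → Disjoint a (b ∖ a)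
  disjoint-∖ a b i aᵢ rewrite aᵢ = ∧-zeroʳ (b i)

  ⊆-refl : {a : BVec n} → a ⊆ a
  ⊆-refl _ = id

  ⊆-trans : {a b c : BVec n} → a ⊆ b → b ⊆ c → a ⊆ c
  ⊆-trans a⊆b b⊆c i = b⊆c i ∘ a⊆b i

  ⊆-∁⇒disjoint : {a b : BVec n} → a ⊆ ∁ b → Disjoint a b
  ⊆-∁⇒disjoint a⊆∁b i aᵢ = not-injective (a⊆∁b i aᵢ)

  disjoint-sym : {a b : BVec n} → Disjoint a b → Disjoint b a
  disjoint-sym {a} a#b i bᵢ with a i in aᵢ
  ... | false = refl
  ... | true  = trans (sym bᵢ) (a#b i aᵢ)

  disjoint-∪ : {a b c : BVec n} → Disjoint a b → Disjoint a c → Disjoint a (b ∪ c)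
  disjoint-∪ a#b a#c i aᵢ rewrite a#b i aᵢ | a#c i aᵢ = refl

  disjoint-mono : {a a′ b b′ : BVec n} → a′ ⊆ a → b′ ⊆ b → Disjoint a b → Disjoint a′ b′
  disjoint-mono {b = b} {b′} a′⊆a b′⊆b a#b i a′ᵢ with b′ i in b′ᵢ
  ... | false = refl
  ... | true  = trans (sym (b′⊆b i b′ᵢ)) (a#b i (a′⊆a i a′ᵢ))

count-cong : ∀ {n} {a b : BVec n} → a ≐ b → count a ≡ count b
count-cong {zero}  a≐b = refl
count-cong {suc n} a≐b = cong₂ (λ p k → (if p then 1 else 0) + k) (a≐b zero) (count-cong (a≐b ∘ suc))

count-mono : ∀ {n} {a b : BVec n} → a ⊆ b → count a ≤ count b
count-mono {zero}  a⊆b = z≤n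
count-mono {suc n} {a} {b} a⊆b = step (a zero) (b zero) (a⊆b zero) (count-mono (a⊆b ∘ suc))
  where
  step : ∀ p q {k l} → (p ≡ true → q ≡ true) → k ≤ l → (if p then 1 else 0) + k ≤ (if q then 1 else 0) + l
  step true  true  _   k≤l = s≤s k≤l
  step true  false p⇒q k≤l with () ← p⇒q refl
  step false true  _   k≤l = m≤n⇒m≤1+n k≤l
  step false false _   k≤l = k≤l

count-∪ : ∀ {n} {a b : BVec n} → Disjoint a b → count (a ∪ b) ≡ count a + count b
count-∪ {zero}  a#b = refl
count-∪ {suc n} {a} {b} a#b = step (a zero) (b zero) (a#b zero) (count-∪ (a#b ∘ suc))
  where
  step : ∀ p q {k l m} → (p ≡ true → q ≡ false) → k ≡ l + m →
         (if p ∨ q then 1 else 0) + k ≡ ((if p then 1 else 0) + l) + ((if q then 1 else 0) + m)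
  step true  true  p#q _ with () ← p#q refl
  step true  false _   k≡ = cong suc k≡
  step false true  {l = l} _ k≡ = trans (cong suc k≡) (sym (+-suc l _))
  step false false _   k≡ = k≡

count-∅ : ∀ {n} → count (∅ {n}) ≡ 0
count-∅ {zero}  = refl
count-∅ {suc n} = count-∅ {n}

count-≡0⇒≐∅ : ∀ {n} {a : BVec n} → count a ≡ 0 → a ≐ ∅
count-≡0⇒≐∅ {suc n} {a} ∣a∣≡0 zero    with a zero | ∣a∣≡0
... | false | _  = refl
... | true  | ()
count-≡0⇒≐∅ {suc n} {a} ∣a∣≡0 (suc i) = count-≡0⇒≐∅ (m+n≡0⇒n≡0 (if a zero then 1 else 0) ∣a∣≡0) i

count-full : ∀ n → count {n} (λ _ → true) ≡ n
count-full zero    = refl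
count-full (suc n) = cong suc (count-full n)

count-split : ∀ {n} (a b : BVec n) → count a ≡ count (a ∩ b) + count (a ∖ b)
count-split a b = trans (count-cong a≐) (count-∪ ∩#∖)
  where
  a≐ : a ≐ (a ∩ b) ∪ (a ∖ b)
  a≐ i with a i | b i
  ... | true  | true  = refl
  ... | true  | false = refl
  ... | false | _     = refl
  ∩#∖ : Disjoint (a ∩ b) (a ∖ b)
  ∩#∖ i aᵢ∧bᵢ rewrite ∧-conicalʳ (a i) (b i) aᵢ∧bᵢ = ∧-zeroʳ (a i)

-- true ∧ b and true ∧ not b reduce to b and not b.
count-∁ : ∀ {n} (a : BVec n) → count a + count (∁ a) ≡ n
count-∁ {n} a = trans (sym (count-split (λ _ → true) a)) (count-full n)

module _ {n : ℕ} where

  count-∖≡0⇒⊆ : {a b : BVec n} → count (a ∖ b) ≡ 0 → a ⊆ b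
  count-∖≡0⇒⊆ {a} {b} ∣a∖b∣≡0 i aᵢ with a i | b i | count-≡0⇒≐∅ ∣a∖b∣≡0 i
  ... | _    | true  | _  = refl
  ... | true | false | ()

  ⊆⇒count-∖≡0 : {a b : BVec n} → a ⊆ b → count (a ∖ b) ≡ 0
  ⊆⇒count-∖≡0 {a} {b} a⊆b = trans (count-cong a∖b≐∅) (count-∅ {n})
    where
    a∖b≐∅ : a ∖ b ≐ ∅
    a∖b≐∅ i with a i in aᵢ
    ... | false = refl
    ... | true  rewrite a⊆b i aᵢ = refl

  count-∩-≥⇒⊆ : {a b : BVec n} → count b ≤ count (a ∩ b) → b ⊆ a
  count-∩-≥⇒⊆ {a} {b} ∣b∣≤ = count-∖≡0⇒⊆ (n≤0⇒n≡0 (+-cancelˡ-≤ (count (b ∩ a)) _ 0 (begin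
    count (b ∩ a) + count (b ∖ a) ≡⟨ count-split b a ⟨
    count b                       ≤⟨ ∣b∣≤ ⟩
    count (a ∩ b)                 ≡⟨ count-cong (λ i → ∧-comm (a i) (b i)) ⟩
    count (b ∩ a)                 ≡⟨ +-identityʳ _ ⟨
    count (b ∩ a) + 0             ∎)))
    where open ≤-Reasoning

  count-∩-split : (a : BVec n) {b c : BVec n} → c ⊆ b → count (a ∩ b) ≡ count (a ∩ c) + count (a ∩ (b ∖ c))
  count-∩-split a {b} {c} c⊆b = trans (count-split (a ∩ b) c)
    (cong₂ _+_ (count-cong (λ i → trans (∧-assoc (a i) (b i) (c i)) (cong (a i ∧_) (⊆⇒∩≐ c⊆b i))))
               (count-cong (λ i → ∧-assoc (a i) (b i) (not (c i)))))

  count-∩-∪ : (a : BVec n) {b c : BVec n} → Disjoint b c → count (a ∩ (b ∪ c)) ≡ count (a ∩ b) + count (a ∩ c)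
  count-∩-∪ a {b} {c} b#c = trans (count-cong (λ i → ∧-distribˡ-∨ (a i) (b i) (c i)))
    (count-∪ (disjoint-mono (∩-⊆ʳ a b) (∩-⊆ʳ a c) b#c))

  count-∖-pos⇒≉ : {a b : BVec n} → 0 < count (a ∖ b) → ¬ a ≐ b
  count-∖-pos⇒≉ {a} {b} 0<∣a∖b∣ a≐b = <⇒≢ 0<∣a∖b∣ (sym (⊆⇒count-∖≡0 λ i aᵢ → trans (sym (a≐b i)) aᵢ))

∷-⊆ : ∀ {n} {a : BVec (suc n)} {p b} → (p ≡ true → a zero ≡ true) → b ⊆ tail a → (p ∷ b) ⊆ a
∷-⊆ p⇒a₀ b⊆a′ zero    = p⇒a₀
∷-⊆ p⇒a₀ b⊆a′ (suc i) = b⊆a′ i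

choose : ∀ {n} (a : BVec n) {k} → k ≤ count a → ∃[ b ] b ⊆ a × count b ≡ k
choose {n} a {zero} _ = ∅ , (λ _ ()) , count-∅ {n}
choose {suc n} a {suc k} k≤∣a∣ with a zero in a₀ | k≤∣a∣
... | true  | s≤s k≤∣a′∣ = let b , b⊆a′ , ∣b∣ = choose (tail a) k≤∣a′∣ in
  true ∷ b , ∷-⊆ (λ _ → a₀) b⊆a′ , cong suc ∣b∣
... | false | k<∣a′∣ = let b , b⊆a′ , ∣b∣ = choose (tail a) k<∣a′∣ in
  false ∷ b , ∷-⊆ (λ ()) b⊆a′ , ∣b∣

extend-disjoint : ∀ {n} {S Z : BVec n} {k} → Disjoint S Z → count Z ≤ k → count S + k ≤ n →
                  ∃[ Z′ ] Z ⊆ Z′ × Disjoint S Z′ × count Z′ ≡ k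
extend-disjoint {n} {S} {Z} {k} S#Z ∣Z∣≤k room =
  let E , E⊆W , ∣E∣ = choose (∁ (S ∪ Z)) k∸∣Z∣≤∣W∣
      S∪Z#E = disjoint-sym (⊆-∁⇒disjoint E⊆W)
  in Z ∪ E
   , ⊆-∪ˡ Z E
   , disjoint-∪ S#Z (disjoint-mono (⊆-∪ˡ S Z) ⊆-refl S∪Z#E)
   , trans (count-∪ (disjoint-mono (⊆-∪ʳ S Z) ⊆-refl S∪Z#E)) (trans (cong (count Z +_) ∣E∣) (m+[n∸m]≡n ∣Z∣≤k))
  where
  k∸∣Z∣≤∣W∣ : k ∸ count Z ≤ count (∁ (S ∪ Z))
  k∸∣Z∣≤∣W∣ = +-cancelˡ-≤ (count S + count Z) _ _ (begin
    count S + count Z + (k ∸ count Z)    ≡⟨ +-assoc (count S) _ _ ⟩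
    count S + (count Z + (k ∸ count Z))  ≡⟨ cong (count S +_) (m+[n∸m]≡n ∣Z∣≤k) ⟩
    count S + k                          ≤⟨ room ⟩
    n                                    ≡⟨ count-∁ (S ∪ Z) ⟨
    count (S ∪ Z) + count (∁ (S ∪ Z))    ≡⟨ cong (_+ count (∁ (S ∪ Z))) (count-∪ S#Z) ⟩
    count S + count Z + count (∁ (S ∪ Z)) ∎)
    where open ≤-Reasoning

m≤n/2⇒m+m≤n : ∀ {m n} → m ≤ n / 2 → m + m ≤ n
m≤n/2⇒m+m≤n {m} {n} m≤n/2 = begin
  m + m             ≤⟨ +-mono-≤ m≤n/2 m≤n/2 ⟩
  n / 2 + n / 2     ≡⟨ cong (n / 2 +_) (+-identityʳ (n / 2)) ⟨
  2 * (n / 2)       ≡⟨ *-comm 2 (n / 2) ⟩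
  n / 2 * 2         ≤⟨ m/n*n≤m n 2 ⟩
  n                 ∎
  where open ≤-Reasoning

threshold-squeeze : ∀ {g u c r z} → c ≤ suc g → u ≤ c + r → r + z < u ∸ g →
                    z ≡ 0 × c ≡ suc g × c + r ≡ u
threshold-squeeze {g} {u} {c} {r} {z} c≤1+g u≤c+r r+z<u∸g = z≡0 , c≡1+g , trans (cong (_+ r) c≡1+g) (sym u≡1+g+r)
  where
  g≤u : g ≤ u
  g≤u = <⇒≤ (m∸n≢0⇒n<m λ u∸g≡0 → n≮0 (subst (r + z <_) u∸g≡0 r+z<u∸g))
  u∸g≤1+r : u ∸ g ≤ suc r
  u∸g≤1+r = +-cancelˡ-≤ g _ _ (begin
    g + (u ∸ g) ≡⟨ m+[n∸m]≡n g≤u ⟩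
    u           ≤⟨ u≤c+r ⟩
    c + r       ≤⟨ +-monoˡ-≤ r c≤1+g ⟩
    suc g + r   ≡⟨ +-suc g r ⟨
    g + suc r   ∎)
    where open ≤-Reasoning
  u∸g≡1+r : u ∸ g ≡ suc r
  u∸g≡1+r = ≤-antisym u∸g≤1+r (≤-<-trans (m≤m+n r z) r+z<u∸g)
  u≡1+g+r : u ≡ suc g + r
  u≡1+g+r = trans (sym (m+[n∸m]≡n g≤u)) (trans (cong (g +_) u∸g≡1+r) (+-suc g r))
  z≡0 : z ≡ 0
  z≡0 = n≤0⇒n≡0 (+-cancelˡ-≤ r z 0 (subst (r + z ≤_) (sym (+-identityʳ r))
          (s≤s⁻¹ (subst (r + z <_) u∸g≡1+r r+z<u∸g))))
  c≡1+g : c ≡ suc g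
  c≡1+g = ≤-antisym c≤1+g (+-cancelʳ-≤ r _ _ (subst (_≤ c + r) u≡1+g+r u≤c+r))

module _ {m n : ℕ} (M : BMat m n) where

  goodRow-sound : ∀ {u S Z I j} → goodRow M u S Z I j ≡ true →
                  count (M j ∩ S) ≡ u × count (M j ∩ Z) ≡ 0 × I ⊆ M j
  goodRow-sound {u} {S} {Z} {I} {j} good =
    ≡ᵇ-sound (∧-conicalˡ _ _ good) , ≡ᵇ-sound (∧-conicalˡ _ _ rest) , count-∖≡0⇒⊆ (≡ᵇ-sound (∧-conicalʳ _ _ rest))
    where
    rest : ((count (M j ∩ Z) ≡ᵇ 0) ∧ (count (I ∖ M j) ≡ᵇ 0)) ≡ true
    rest = ∧-conicalʳ (count (M j ∩ S) ≡ᵇ u) _ good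
    ≡ᵇ-sound : ∀ {k l} → (k ≡ᵇ l) ≡ true → k ≡ l
    ≡ᵇ-sound = ≡ᵇ⇒≡ _ _ ∘ Equivalence.from T-≡

  goodRow-complete : ∀ {u S Z I j} → count (M j ∩ S) ≡ u → count (M j ∩ Z) ≡ 0 → I ⊆ M j →
                     goodRow M u S Z I j ≡ true
  goodRow-complete ∣a∩S∣≡u ∣a∩Z∣≡0 I⊆a =
    cong₂ _∧_ (≡ᵇ-complete ∣a∩S∣≡u) (cong₂ _∧_ (≡ᵇ-complete ∣a∩Z∣≡0) (≡ᵇ-complete (⊆⇒count-∖≡0 I⊆a)))
    where
    ≡ᵇ-complete : ∀ {k l} → k ≡ l → (k ≡ᵇ l) ≡ true
    ≡ᵇ-complete = Equivalence.to T-≡ ∘ ≡⇒≡ᵇ _ _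

  threshold : BVec n → ℕ → BVec m
  threshold x t j = does (t ≤? count (M j ∩ x))

  threshold-∈ : ∀ {x ℓ t u} → ℓ ≤ t → t ≤ u → InOutcome M x ℓ u (threshold x t)
  threshold-∈ ℓ≤t t≤u j =
      (λ u≤ → dec-true (_ ≤? _) (≤-trans t≤u u≤))
    , (λ <ℓ → dec-false (_ ≤? _) (λ t≤ → <⇒≱ <ℓ (≤-trans ℓ≤t t≤)))

  threshold-∖ : ∀ {x x′ t t′ j} → (threshold x t ∖ threshold x′ t′) j ≡ true →
                t ≤ count (M j ∩ x) × count (M j ∩ x′) < t′
  threshold-∖ {x} {x′} {t} {t′} {j} h =
      invert (subst (Reflects _) (∧-conicalˡ _ _ h) (proof (t ≤? count (M j ∩ x))))
    , ≰⇒> (invert (subst (Reflects _) (not-injective (∧-conicalʳ _ _ h)) (proof (t′ ≤? count (M j ∩ x′)))))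

overlap-loss : ∀ {n} (a : BVec n) {x x′ I : BVec n} → I ⊆ a → I ⊆ x → Disjoint I x′ →
               count (a ∩ (x′ ∖ x)) ≡ 0 → count (a ∩ x′) + count I ≤ count (a ∩ x)
overlap-loss a {x} {x′} {I} I⊆a I⊆x I#x′ ∣a∩x′∖x∣≡0 = begin
  count (a ∩ x′) + count I                        ≤⟨ +-monoˡ-≤ (count I) ∣a∩x′∣≤ ⟩
  count (a ∩ (x ∖ I)) + count I                   ≡⟨ +-comm _ (count I) ⟩
  count I + count (a ∩ (x ∖ I))                   ≡⟨ cong (_+ count (a ∩ (x ∖ I))) (count-cong (⊆⇒∩≐ I⊆a)) ⟨
  count (a ∩ I) + count (a ∩ (x ∖ I))             ≡⟨ count-∩-split a I⊆x ⟨
  count (a ∩ x)                                   ∎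
  where
  open ≤-Reasoning
  x′-cover : x′ ⊆ (x ∖ I) ∪ (x′ ∖ x)
  x′-cover i x′ᵢ rewrite x′ᵢ | disjoint-sym I#x′ i x′ᵢ with x i
  ... | true  = refl
  ... | false = refl
  ∣a∩x′∣≤ : count (a ∩ x′) ≤ count (a ∩ (x ∖ I))
  ∣a∩x′∣≤ = begin
    count (a ∩ x′)                                ≤⟨ count-mono (∩-monoʳ a x′-cover) ⟩
    count (a ∩ ((x ∖ I) ∪ (x′ ∖ x)))              ≡⟨ count-∩-∪ a (disjoint-mono (∩-⊆ˡ x (∁ I)) ⊆-refl (disjoint-∖ x x′)) ⟩
    count (a ∩ (x ∖ I)) + count (a ∩ (x′ ∖ x))    ≡⟨ cong (count (a ∩ (x ∖ I)) +_) ∣a∩x′∖x∣≡0 ⟩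
    count (a ∩ (x ∖ I)) + 0                       ≡⟨ +-identityʳ _ ⟩
    count (a ∩ (x ∖ I))                           ∎

disjunct⇒separating : ∀ {m n} (M : BMat m n) {d e u g} → Disjunct M d e u g → Separating M d e u g (u ∸ g)
disjunct⇒separating M {u = u} {g = g} disjunct x x′ (_ , ∣x∣≤d , _) u≤∣x∣ _ g<∣x∖x′∣ ∣x′∖x∣≤∣x∣ y y′ y∈ y′∈
  with choose (x ∖ x′) g<∣x∖x′∣
... | I , I⊆x∖x′ , ∣I∣ =
  <-≤-trans (disjunct x (x′ ∖ x) I u≤∣x∣ ∣x∣≤d ∣x′∖x∣≤∣x∣ (disjoint-∖ x x′) I⊆x ∣I∣)
            (count-mono good⊆y∖y′)
  where
  I⊆x : I ⊆ x
  I⊆x = ⊆-trans I⊆x∖x′ (∩-⊆ˡ x (∁ x′))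
  I#x′ : Disjoint I x′
  I#x′ = ⊆-∁⇒disjoint (⊆-trans I⊆x∖x′ (∩-⊆ʳ x (∁ x′)))
  separates : ∀ {j} → count (M j ∩ x) ≡ u × count (M j ∩ (x′ ∖ x)) ≡ 0 × I ⊆ M j → (y ∖ y′) j ≡ true
  separates {j} (∣a∩x∣≡u , ∣a∩x′∖x∣≡0 , I⊆a) =
    cong₂ (λ p q → p ∧ not q) (proj₁ (y∈ j) (≤-reflexive (sym ∣a∩x∣≡u))) (proj₂ (y′∈ j) below)
    where
    below : count (M j ∩ x′) < u ∸ g
    below = m+n≤o⇒m≤o∸n (suc (count (M j ∩ x′))) (begin
      suc (count (M j ∩ x′)) + g   ≡⟨ +-suc _ g ⟨
      count (M j ∩ x′) + suc g     ≡⟨ cong (count (M j ∩ x′) +_) ∣I∣ ⟨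
      count (M j ∩ x′) + count I   ≤⟨ overlap-loss (M j) I⊆a I⊆x I#x′ ∣a∩x′∖x∣≡0 ⟩
      count (M j ∩ x)              ≡⟨ ∣a∩x∣≡u ⟩
      u                            ∎)
      where open ≤-Reasoning
  good⊆y∖y′ : goodRow M u x (x′ ∖ x) I ⊆ y ∖ y′
  good⊆y∖y′ j good = separates (goodRow-sound M good)

exchange : ∀ {n} → BVec n → BVec n → BVec n → BVec n
exchange S I Z′ = (S ∖ I) ∪ Z′

module _ {n : ℕ} {S I Z′ : BVec n} where

  ∖-exchange : I ⊆ S → Disjoint S Z′ → S ∖ exchange S I Z′ ≐ I
  ∖-exchange I⊆S S#Z′ i with S i in Sᵢ | I i in Iᵢ
  ... | true  | true  rewrite S#Z′ i Sᵢ = refl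
  ... | true  | false = refl
  ... | false | false = refl
  ... | false | true  with () ← trans (sym Sᵢ) (I⊆S i Iᵢ)

  exchange-∖ : Disjoint S Z′ → exchange S I Z′ ∖ S ≐ Z′
  exchange-∖ S#Z′ i with S i in Sᵢ
  ... | true  rewrite S#Z′ i Sᵢ = ∧-zeroʳ _
  ... | false = ∧-identityʳ (Z′ i)

  count-exchange : Disjoint S Z′ → count (exchange S I Z′) ≡ count (S ∖ I) + count Z′
  count-exchange S#Z′ = count-∪ (disjoint-mono (∩-⊆ˡ S (∁ I)) ⊆-refl S#Z′)

  count-∩-exchange : (a : BVec n) → Disjoint S Z′ →
                     count (a ∩ exchange S I Z′) ≡ count (a ∩ (S ∖ I)) + count (a ∩ Z′)
  count-∩-exchange a S#Z′ = count-∩-∪ a (disjoint-mono (∩-⊆ˡ S (∁ I)) ⊆-refl S#Z′)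

exchange-gap-row : ∀ {n g u} (a : BVec n) {S Z Z′ I : BVec n} → I ⊆ S → Disjoint S Z′ → Z ⊆ Z′ →
                   count I ≡ suc g → u ≤ count (a ∩ S) → count (a ∩ exchange S I Z′) < u ∸ g →
                   count (a ∩ S) ≡ u × count (a ∩ Z) ≡ 0 × I ⊆ a
exchange-gap-row {g = g} {u} a {S} {Z} {Z′} {I} I⊆S S#Z′ Z⊆Z′ ∣I∣ u≤∣a∩S∣ ∣a∩x′∣<u∸g =
  let ∣a∩Z′∣≡0 , ∣a∩I∣≡1+g , ∣a∩I∣+∣a∩S∖I∣≡u = threshold-squeeze ∣a∩I∣≤1+g u≤∣a∩I∣+∣a∩S∖I∣ ∣a∩S∖I∣+∣a∩Z′∣<u∸g in
    trans ∣a∩S∣ ∣a∩I∣+∣a∩S∖I∣≡u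
  , n≤0⇒n≡0 (subst (count (a ∩ Z) ≤_) ∣a∩Z′∣≡0 (count-mono (∩-monoʳ a Z⊆Z′)))
  , count-∩-≥⇒⊆ (≤-reflexive (trans ∣I∣ (sym ∣a∩I∣≡1+g)))
  where
  ∣a∩S∣ : count (a ∩ S) ≡ count (a ∩ I) + count (a ∩ (S ∖ I))
  ∣a∩S∣ = count-∩-split a I⊆S
  ∣a∩I∣≤1+g : count (a ∩ I) ≤ suc g
  ∣a∩I∣≤1+g = subst (count (a ∩ I) ≤_) ∣I∣ (count-mono (∩-⊆ʳ a I))
  u≤∣a∩I∣+∣a∩S∖I∣ : u ≤ count (a ∩ I) + count (a ∩ (S ∖ I))
  u≤∣a∩I∣+∣a∩S∖I∣ = subst (u ≤_) ∣a∩S∣ u≤∣a∩S∣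
  ∣a∩S∖I∣+∣a∩Z′∣<u∸g : count (a ∩ (S ∖ I)) + count (a ∩ Z′) < u ∸ g
  ∣a∩S∖I∣+∣a∩Z′∣<u∸g = subst (_< u ∸ g) (count-∩-exchange a S#Z′) ∣a∩x′∣<u∸g

exchange-distinguishable : ∀ {n d u g} {S I Z′ : BVec n} → I ⊆ S → Disjoint S Z′ → count I ≡ suc g →
                           count Z′ ≡ count S → u ≤ count S → count S + count S ≤ d →
                           Distinguishable d u g S (exchange S I Z′) × u ≤ count (exchange S I Z′)
                           × g < diff S (exchange S I Z′) × diff (exchange S I Z′) S ≤ count S
exchange-distinguishable {d = d} {u} {g} {S} {I} {Z′} I⊆S S#Z′ ∣I∣ ∣Z′∣ u≤∣S∣ ∣S∣+∣S∣≤d =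
    (S≉x′ , m+n≤o⇒m≤o (count S) ∣S∣+∣S∣≤d , ∣x′∣≤d , inj₁ u≤∣S∣ , inj₁ g<∣S∖x′∣)
  , ≤-trans u≤∣S∣ (≤-trans (m≤n+m (count S) _) (≤-reflexive (sym ∣x′∣)))
  , g<∣S∖x′∣
  , ≤-reflexive (trans (count-cong (exchange-∖ S#Z′)) ∣Z′∣)
  where
  ∣S∖I∣+∣I∣ : count (S ∖ I) + count I ≡ count S
  ∣S∖I∣+∣I∣ = trans (+-comm _ (count I)) (sym (trans (count-split S I) (cong (_+ count (S ∖ I)) (count-cong (⊆⇒∩≐ I⊆S)))))
  ∣x′∣ : count (exchange S I Z′) ≡ count (S ∖ I) + count S
  ∣x′∣ = trans (count-exchange S#Z′) (cong (count (S ∖ I) +_) ∣Z′∣)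
  ∣x′∣≤d : count (exchange S I Z′) ≤ d
  ∣x′∣≤d = ≤-trans (≤-reflexive ∣x′∣) (≤-trans (+-monoˡ-≤ (count S) (m+n≤o⇒m≤o _ (≤-reflexive ∣S∖I∣+∣I∣))) ∣S∣+∣S∣≤d)
  ∣S∖x′∣ : diff S (exchange S I Z′) ≡ suc g
  ∣S∖x′∣ = trans (count-cong (∖-exchange I⊆S S#Z′)) ∣I∣
  g<∣S∖x′∣ : g < diff S (exchange S I Z′)
  g<∣S∖x′∣ = ≤-reflexive (sym ∣S∖x′∣)
  S≉x′ : ¬ S ≐ exchange S I Z′
  S≉x′ = count-∖-pos⇒≉ (subst (0 <_) (sym ∣S∖x′∣) z<s)

separating⇒disjunct : ∀ {m n} (M : BMat m n) {d e u g} → d ≤ n →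
                      Separating M d e u g (u ∸ g) → Disjunct M (d / 2) e u g
separating⇒disjunct {m} {n} M {u = u} {g = g} d≤n separating S Z I u≤∣S∣ ∣S∣≤d/2 ∣Z∣≤∣S∣ S#Z I⊆S ∣I∣
  with extend-disjoint S#Z ∣Z∣≤∣S∣ (≤-trans (m≤n/2⇒m+m≤n ∣S∣≤d/2) d≤n)
... | Z′ , Z⊆Z′ , S#Z′ , ∣Z′∣ =
  let S-x′-distinguishable , u≤∣x′∣ , g<∣S∖x′∣ , ∣x′∖S∣≤∣S∣ =
        exchange-distinguishable I⊆S S#Z′ ∣I∣ ∣Z′∣ u≤∣S∣ (m≤n/2⇒m+m≤n ∣S∣≤d/2)
  in <-≤-trans (separating S x′ S-x′-distinguishable u≤∣S∣ u≤∣x′∣ g<∣S∖x′∣ ∣x′∖S∣≤∣S∣ y y′ y∈ y′∈)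
               (count-mono y∖y′⊆good)
  where
  x′ : BVec n
  x′ = exchange S I Z′
  -- the outcome of S with the fewest ones and that of x′ with the most
  y y′ : BVec m
  y = threshold M S u
  y′ = threshold M x′ (u ∸ g)
  y∈ : InOutcome M S (u ∸ g) u y
  y∈ = threshold-∈ M (m∸n≤m u g) ≤-refl
  y′∈ : InOutcome M x′ (u ∸ g) u y′
  y′∈ = threshold-∈ M ≤-refl (m∸n≤m u g)
  y∖y′⊆good : y ∖ y′ ⊆ goodRow M u S Z I
  y∖y′⊆good j separated =
    let u≤∣a∩S∣ , ∣a∩x′∣<u∸g = threshold-∖ M separated
        ∣a∩S∣≡u , ∣a∩Z∣≡0 , I⊆a = exchange-gap-row (M j) I⊆S S#Z′ Z⊆Z′ ∣I∣ u≤∣a∩S∣ ∣a∩x′∣<u∸g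
    in goodRow-complete M ∣a∩S∣≡u ∣a∩Z∣≡0 I⊆a

lemma14 : (m n d e u g : ℕ) → g < u → u ≤ d → d ≤ n → (M : BMat m n) →
    (Disjunct M d e u g → Separating M d e u g (u ∸ g))
    × (d + g < n → Separating M d e u g (u ∸ g) → Disjunct M (d / 2) e u g)
-- Neither direction needs g < u or u ≤ d, and the converse only needs d ≤ n.
lemma14 m n d e u g _ _ d≤n M = disjunct⇒separating M , λ _ → separating⇒disjunct M d≤n
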